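{- Let $T$ be a well-totally dominated balanced tree of height 3. Then there exists $u\in V_2$ such that $|N(u)\cap V_3|=1$.
   Context: $N(u)$ is the open neighborhood of $u$. A leaf is a vertex of degree 1; the height of a vertex is its minimum distance to a leaf; $V_k$ is the set of vertices of height $k$; the height of $T$ is the maximum height of a vertex. A tree is balanced if no two vertices of the same height are adjacent. A total dominating set is a set $S$ with $N(S)=V(T)$ ($N(S)$ = union of open neighborhoods); $T$ is well-totally dominated if all its inclusion-minimal total dominating sets have the same size. -}

module Defs where

open import Data.Nat using (ℕ; zero; suc; _<_; _≤_)
open import Data.Fin using (Fin; zero; suc; inject₁; fromℕ)
open import Data.Fin.Subset using (Subset; _∈_; _⊆_; ∣_∣)
open import Data.Bool using (Bool; true)
open import Data.Product using (Σ; ∃; _×_; _,_)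
open import Data.Empty using (⊥)
open import Function.Definitions using (Injective)
open import Relation.Binary.PropositionalEquality using (_≡_)
open import Relation.Nullary using (¬_)

record Graph (n : ℕ) : Set where
  field
    adj     : Fin n → Fin n → Bool
    symm    : ∀ u v → adj u v ≡ true → adj v u ≡ true
    irrefl  : ∀ u → ¬ (adj u u ≡ true)

module _ {n : ℕ} (G : Graph n) where
  open Graph G

  Adj : Fin n → Fin n → Set
  Adj u v = adj u v ≡ true

  data Walk : Fin n → Fin n → ℕ → Set where
    here : ∀ {u} → Walk u u zero
    step : ∀ {u w v k} → Adj u w → Walk w v k → Walk u v (suc k)

  Connected : Set
  Connected = ∀ u v → ∃ λ k → Walk u v k

  record Cycle : Set where
    field
      m         : ℕ
      f         : Fin (suc (suc (suc m))) → Fin n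
      f-inj     : Injective _≡_ _≡_ f
      f-adj     : ∀ (i : Fin (suc (suc m))) → Adj (f (inject₁ i)) (f (suc i))
      f-closing : Adj (f (fromℕ (suc (suc m)))) (f zero)

  Acyclic : Set
  Acyclic = ¬ Cycle

  IsTree : Set
  IsTree = Connected × Acyclic

  Leaf : Fin n → Set
  Leaf u = ∃ λ v → Adj u v × (∀ w → Adj u w → w ≡ v)

  -- Height u k : the minimum distance from u to a leaf is k
  -- (some leaf is at distance k, i.e. reachable by a walk of length k,
  --  and no leaf is reachable by a walk shorter than k)
  Height : Fin n → ℕ → Set
  Height u k = (∃ λ ℓ → Leaf ℓ × Walk u ℓ k)
             × (∀ ℓ j → Leaf ℓ → j < k → ¬ Walk u ℓ j)

  GraphHeight : ℕ → Set
  GraphHeight h = (∃ λ u → Height u h) × (∀ u k → Height u k → k ≤ h)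

  Balanced : Set
  Balanced = ∀ u v k → Adj u v → Height u k → Height v k → ⊥

  TotalDominating : Subset n → Set
  TotalDominating S = ∀ v → ∃ λ u → u ∈ S × Adj u v

  MinimalTotalDominating : Subset n → Set
  MinimalTotalDominating S =
    TotalDominating S × (∀ S′ → S′ ⊆ S → TotalDominating S′ → S′ ≡ S)

  WellTotallyDominated : Set
  WellTotallyDominated =
    ∀ S S′ → MinimalTotalDominating S → MinimalTotalDominating S′ → ∣ S ∣ ≡ ∣ S′ ∣

-- Balance and maximality of height 3 make the vertices of heights 2 and 3 induce a
-- forest in which every edge joins height 2 to height 3 and every height-3 vertex
-- keeps all of its (at least two) neighbours. A finite forest with an edge has a
-- vertex of degree one, since otherwise a non-backtracking walk could be continued
-- forever and, by pigeonhole, would close up into a cycle. That vertex cannot have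
-- height 3, so it is a height-2 vertex with a unique height-3 neighbour.
module Submission where

open import Defs
open import Data.Nat using (ℕ; zero; suc; _+_; _∸_; _<_; _≤_; s≤s; z<s; s<s)
open import Data.Nat.Properties
  using ( <⇒≤; ≤-refl; ≤-trans; ≤-<-trans; n≤1+n; 1+n≰n; m<n⇒m<1+n; m<1+n⇒m<n∨m≡n
        ; m∸n≤m; m∸n+n≡m; m<n⇒0<n∸m; m≤o∸n⇒m+n≤o)
open import Data.Nat.Induction using (<-wellFounded)
open import Data.Fin using (Fin; toℕ; inject₁; fromℕ)
import Data.Fin as Fin
open import Data.Fin.Properties
  using (any?; all?; _≟_; pigeonhole; <-cmp; toℕ<n; toℕ≤n; toℕ≤pred[n]; toℕ-inject₁; toℕ-fromℕ)
  renaming (_<?_ to _<ᶠ?_)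
import Data.Bool as Bool
open import Data.Bool using (true)
open import Data.Product using (∃; ∃₂; _×_; _,_; proj₁; proj₂)
open import Data.Sum using (_⊎_; inj₁; inj₂)
open import Data.Empty using (⊥-elim)
open import Function.Definitions using (Injective)
open import Induction.WellFounded using (Acc; acc)
open import Relation.Binary.Definitions using (tri<; tri≈; tri>)
open import Relation.Binary.PropositionalEquality using (_≡_; _≢_; refl; sym; subst)
open import Relation.Nullary using (¬_; Dec; yes; no; ¬?)
open import Relation.Nullary.Decidable using (_×-dec_; _⊎-dec_; _→-dec_; decidable-stable)
open import Relation.Unary using (Pred; Decidable)

Repetition : ∀ {m n} → (Fin m → Fin n) → Set
Repetition f = ∃₂ λ i j → i Fin.< j × f i ≡ f j

repetition? : ∀ {m n} (f : Fin m → Fin n) → Dec (Repetition f)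
repetition? f = any? λ i → any? λ j → (i <ᶠ? j) ×-dec (f i ≟ f j)

¬repetition⇒injective : ∀ {m n} {f : Fin m → Fin n} → ¬ Repetition f → Injective _≡_ _≡_ f
¬repetition⇒injective none {i} {j} fi≡fj with <-cmp i j
... | tri< i<j _ _ = ⊥-elim (none (i , j , i<j , fi≡fj))
... | tri≈ _ i≡j _ = i≡j
... | tri> _ _ j<i = ⊥-elim (none (j , i , j<i , sym fi≡fj))

module _ {n : ℕ} (G : Graph n) where
  open Graph G using (adj; symm; irrefl)

  adj? : ∀ u v → Dec (Adj G u v)
  adj? u v = adj u v Bool.≟ true

  -- Only vertex 0, …, vertex L belong to the walk; later values are unconstrained.
  record NonBacktrackingWalk (L : ℕ) : Set where
    field
      vertex          : ℕ → Fin n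
      adjacent        : ∀ k → k < L → Adj G (vertex k) (vertex (suc k))
      nonBacktracking : ∀ k → 2 + k ≤ L → vertex k ≢ vertex (2 + k)

  open NonBacktrackingWalk

  edgeWalk : ∀ {u v} → Adj G u v → NonBacktrackingWalk 1
  edgeWalk {u} {v} u~v = record
    { vertex          = λ { zero → u ; (suc _) → v }
    ; adjacent        = λ { zero _ → u~v ; (suc _) (s≤s ()) }
    ; nonBacktracking = λ { _ (s≤s ()) }
    }

  prepend : ∀ {L} (w : NonBacktrackingWalk (suc L)) x
          → Adj G x (vertex w 0) → x ≢ vertex w 1 → NonBacktrackingWalk (suc (suc L))
  prepend w x x~w₀ x≢w₁ = record
    { vertex          = λ { zero → x ; (suc k) → vertex w k }
    ; adjacent        = λ { zero _ → x~w₀ ; (suc k) (s≤s k<) → adjacent w k k< }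
    ; nonBacktracking = λ { zero _ → x≢w₁ ; (suc k) (s≤s k<) → nonBacktracking w k k< }
    }

  segment : ∀ {L i j} → NonBacktrackingWalk L → i ≤ j → j ≤ L → NonBacktrackingWalk (j ∸ i)
  segment {L} {i} {j} w i≤j j≤L = record
    { vertex          = λ k → vertex w (k + i)
    ; adjacent        = λ k k< → adjacent w (k + i) (within (suc k) k<)
    ; nonBacktracking = λ k k< → nonBacktracking w (k + i) (within (2 + k) k<)
    }
    where
    within : ∀ m → m ≤ j ∸ i → m + i ≤ L
    within m m≤ = ≤-trans (m≤o∸n⇒m+n≤o m i≤j m≤) j≤L

  segment-closed : ∀ {L i j} (w : NonBacktrackingWalk L) (i≤j : i ≤ j) (j≤L : j ≤ L)
                 → vertex w i ≡ vertex w j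
                 → vertex (segment w i≤j j≤L) 0 ≡ vertex (segment w i≤j j≤L) (j ∸ i)
  segment-closed w i≤j _ wᵢ≡wⱼ rewrite m∸n+n≡m i≤j = wᵢ≡wⱼ

  simpleClosedWalk⇒cycle : ∀ L (w : NonBacktrackingWalk L) → 0 < L → vertex w 0 ≡ vertex w L
                         → Injective _≡_ _≡_ (λ (i : Fin L) → vertex w (toℕ i)) → Cycle G
  simpleClosedWalk⇒cycle 1 w _ closed _ =
    ⊥-elim (irrefl _ (subst (Adj G (vertex w 0)) (sym closed) (adjacent w 0 z<s)))
  simpleClosedWalk⇒cycle 2 w _ closed _ = ⊥-elim (nonBacktracking w 0 ≤-refl closed)
  simpleClosedWalk⇒cycle (suc (suc (suc m))) w _ closed injective = record
    { m = m ; f = λ i → vertex w (toℕ i) ; f-inj = injective ; f-adj = f-adj ; f-closing = f-closing }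
    where
    f-adj : ∀ i → Adj G (vertex w (toℕ (inject₁ i))) (vertex w (suc (toℕ i)))
    f-adj i rewrite toℕ-inject₁ i = adjacent w (toℕ i) (s≤s (toℕ≤n i))
    f-closing : Adj G (vertex w (toℕ (fromℕ (2 + m)))) (vertex w 0)
    f-closing rewrite toℕ-fromℕ (2 + m) | closed = adjacent w (2 + m) ≤-refl

  closedWalk⇒cycle : ∀ {L} → Acc _<_ L → (w : NonBacktrackingWalk L) → 0 < L
                   → vertex w 0 ≡ vertex w L → Cycle G
  closedWalk⇒cycle {L} (acc shorter) w 0<L closed with repetition? (λ (i : Fin L) → vertex w (toℕ i))
  ... | no none = simpleClosedWalk⇒cycle L w 0<L closed (¬repetition⇒injective none)
  ... | yes (i , j , i<j , wᵢ≡wⱼ) =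
    closedWalk⇒cycle (shorter (≤-<-trans (m∸n≤m (toℕ j) (toℕ i)) (toℕ<n j)))
      (segment w (<⇒≤ i<j) j≤L) (m<n⇒0<n∸m i<j) (segment-closed w (<⇒≤ i<j) j≤L wᵢ≡wⱼ)
    where
    j≤L : toℕ j ≤ L
    j≤L = <⇒≤ (toℕ<n j)

  longWalk⇒cycle : ∀ {L} → NonBacktrackingWalk L → n ≤ L → Cycle G
  longWalk⇒cycle {L} w n≤L with pigeonhole (s≤s n≤L) (λ (i : Fin (suc L)) → vertex w (toℕ i))
  ... | i , j , i<j , wᵢ≡wⱼ =
    closedWalk⇒cycle (<-wellFounded _) (segment w (<⇒≤ i<j) j≤L) (m<n⇒0<n∸m i<j)
      (segment-closed w (<⇒≤ i<j) j≤L wᵢ≡wⱼ)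
    where
    j≤L : toℕ j ≤ L
    j≤L = toℕ≤pred[n] j

  InducedLeaf : ∀ {s} → Pred (Fin n) s → Fin n → Fin n → Set s
  InducedLeaf S u v = S u × S v × Adj G u v × (∀ w → S w → Adj G u w → w ≡ v)

  module _ {s} {S : Pred (Fin n) s} (S? : Decidable S) where

    longInducedWalkOrLeaf : ∀ {u v} → S u → S v → Adj G u v → ∀ L
      → (∃ λ (w : NonBacktrackingWalk (suc L)) → S (vertex w 0) × S (vertex w 1))
      ⊎ ∃₂ (InducedLeaf S)
    longInducedWalkOrLeaf su sv u~v zero = inj₁ (edgeWalk u~v , su , sv)
    longInducedWalkOrLeaf su sv u~v (suc L) with longInducedWalkOrLeaf su sv u~v L
    ... | inj₂ leaf = inj₂ leaf
    ... | inj₁ (w , s₀ , s₁)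
      with any? (λ x → S? x ×-dec adj? (vertex w 0) x ×-dec ¬? (x ≟ vertex w 1))
    ...   | yes (x , sx , w₀~x , x≢w₁) = inj₁ (prepend w x (symm _ _ w₀~x) x≢w₁ , sx , s₀)
    ...   | no noOther = inj₂ (_ , _ , s₀ , s₁ , adjacent w 0 z<s , onlyNeighbour)
      where
      onlyNeighbour : ∀ x → S x → Adj G (vertex w 0) x → x ≡ vertex w 1
      onlyNeighbour x sx w₀~x =
        decidable-stable (x ≟ vertex w 1) λ x≢w₁ → noOther (x , sx , w₀~x , x≢w₁)

    acyclic⇒inducedLeaf : Acyclic G → ∀ {u v} → S u → S v → Adj G u v → ∃₂ (InducedLeaf S)
    acyclic⇒inducedLeaf acyclic su sv u~v with longInducedWalkOrLeaf su sv u~v n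
    ... | inj₁ (w , _) = ⊥-elim (acyclic (longWalk⇒cycle w (n≤1+n n)))
    ... | inj₂ leaf = leaf

  ReachesLeafIn : Fin n → ℕ → Set
  ReachesLeafIn u k = ∃ λ ℓ → Leaf G ℓ × Walk G u ℓ k

  NoLeafWalkBelow : Fin n → ℕ → Set
  NoLeafWalkBelow u k = ∀ ℓ j → Leaf G ℓ → j < k → ¬ Walk G u ℓ j

  leaf? : ∀ u → Dec (Leaf G u)
  leaf? u = any? λ v → adj? u v ×-dec all? λ w → adj? u w →-dec (w ≟ v)

  reachesLeafIn? : ∀ u k → Dec (ReachesLeafIn u k)
  reachesLeafIn? u zero with leaf? u
  ... | yes leaf = yes (u , leaf , here)
  ... | no ¬leaf = no λ { (_ , leaf , here) → ¬leaf leaf }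
  reachesLeafIn? u (suc k) with any? (λ v → adj? u v ×-dec reachesLeafIn? v k)
  ... | yes (v , u~v , ℓ , leaf , walk) = yes (ℓ , leaf , step u~v walk)
  ... | no none = no λ { (ℓ , leaf , step {w = v} u~v walk) → none (v , u~v , ℓ , leaf , walk) }

  noLeafWalkBelow-suc : ∀ {u k} → NoLeafWalkBelow u k → ¬ ReachesLeafIn u k
                      → NoLeafWalkBelow u (suc k)
  noLeafWalkBelow-suc below unreachable ℓ j leaf j<1+k walk with m<1+n⇒m<n∨m≡n j<1+k
  ... | inj₁ j<k  = below ℓ j leaf j<k walk
  ... | inj₂ refl = unreachable (ℓ , leaf , walk)

  noLeafWalkBelow? : ∀ u k → Dec (NoLeafWalkBelow u k)
  noLeafWalkBelow? u zero = yes λ _ _ _ ()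
  noLeafWalkBelow? u (suc k) with noLeafWalkBelow? u k | reachesLeafIn? u k
  ... | yes below | no unreachable = yes (noLeafWalkBelow-suc below unreachable)
  ... | no ¬below | _ = no λ below → ¬below λ ℓ j leaf j<k → below ℓ j leaf (m<n⇒m<1+n j<k)
  ... | _ | yes (ℓ , leaf , walk) = no λ below → below ℓ k leaf ≤-refl walk

  height? : ∀ u k → Dec (Height G u k)
  height? u k = reachesLeafIn? u k ×-dec noLeafWalkBelow? u k

  noLeafWalkBelow-neighbour : ∀ {u v k} → Adj G u v → NoLeafWalkBelow u (suc k) → NoLeafWalkBelow v k
  noLeafWalkBelow-neighbour u~v below ℓ j leaf j<k walk = below ℓ (suc j) leaf (s<s j<k) (step u~v walk)

  height-suc⇒¬Leaf : ∀ {u k} → Height G u (suc k) → ¬ Leaf G u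
  height-suc⇒¬Leaf {u} (_ , below) leaf = below u 0 leaf z<s here

  module _ (balanced : Balanced G) {k : ℕ} (maxHeight : GraphHeight G (suc k)) where

    -- A neighbour of a vertex of height k + 1 has height k, k + 1 or k + 2;
    -- balance excludes k + 1 and maximality excludes k + 2.
    maxHeight-neighbour : ∀ {u v} → Height G u (suc k) → Adj G u v → Height G v k
    maxHeight-neighbour {u} {v} height@((ℓ , leaf , walk) , belowᵤ) u~v
      with noLeafWalkBelow-neighbour u~v belowᵤ | reachesLeafIn? v k | reachesLeafIn? v (suc k)
    ... | below | yes reach | _ = reach , below
    ... | below | no ¬reachₖ | yes reach =
      ⊥-elim (balanced u v (suc k) u~v height (reach , noLeafWalkBelow-suc below ¬reachₖ))
    ... | below | no ¬reachₖ | no ¬reach = ⊥-elim (1+n≰n (proj₂ maxHeight v (2 + k)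
      ( (ℓ , leaf , step (symm _ _ u~v) walk)
      , noLeafWalkBelow-suc (noLeafWalkBelow-suc below ¬reachₖ) ¬reach)))

    maxHeight-edge : ∃₂ λ u v → Height G u (suc k) × Height G v k × Adj G u v
    maxHeight-edge with proj₁ maxHeight
    ... | u , height@((_ , _ , step {w = v} u~v _) , _) =
      u , v , height , maxHeight-neighbour height u~v , u~v

corollary6p6 : ∀ {n : ℕ} (T : Graph n) → IsTree T → WellTotallyDominated T
    → Balanced T → GraphHeight T 3
    → ∃ λ (u : Fin n) → Height T u 2
        × (∃ λ (v : Fin n) → Adj T u v × Height T v 3
             × (∀ w → Adj T u w → Height T w 3 → w ≡ v))
corollary6p6 T (_ , acyclic) _ balanced height3
  with maxHeight-edge T balanced height3
... | a , b , a3 , b2 , a~b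
  with acyclic⇒inducedLeaf T (λ u → height? T u 2 ⊎-dec height? T u 3) acyclic (inj₂ a3) (inj₁ b2) a~b
... | u , v , inj₁ u2 , inj₁ v2 , u~v , _ = ⊥-elim (balanced u v 2 u~v u2 v2)
... | u , v , inj₁ u2 , inj₂ v3 , u~v , onlyNeighbour =
  u , u2 , v , u~v , v3 , λ w u~w w3 → onlyNeighbour w (inj₂ w3) u~w
... | u , v , inj₂ u3 , _ , u~v , onlyNeighbour =
  ⊥-elim (height-suc⇒¬Leaf T u3 (v , u~v , λ w u~w →
    onlyNeighbour w (inj₁ (maxHeight-neighbour T balanced height3 u3 u~w)) u~w))
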